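{- Let $\mathcal P$ be any (probabilistic or deterministic) exploration protocol for $k$ robots in a ring of $n>k$ nodes. Then for every sequential computation $c$ of $\mathcal P$ that terminates, $\mathcal{MRP}(c)$ has at least $n-k+1$ configurations containing a tower.
   Context: Model. A ring has $n$ nodes $u_0,\dots,u_{n-1}$ (indices modulo $n$), $u_i$ adjacent to $u_{i-1}$ and $u_{i+1}$; nodes are anonymous and the ring is unoriented. There are $k\le n$ robots located on nodes. Robots are anonymous, uniform (same program, no local parameter), oblivious (no memory between cycles) and do not communicate. A protocol is this common program. Each robot repeatedly executes Look–Compute–Move cycles: in Look it observes the number $d_j(t)$ of robots on every node $u_j$, seen from its own node $u_i$ as the unordered pair $\{\gamma^{+i}(t),\gamma^{ -i}(t)\}$ with $\gamma^{+i}(t)=\langle d_i d_{i+1}\dots d_{i+n-1}\rangle$ and $\gamma^{ -i}(t)=\langle d_i d_{i-1}\dots d_{i-(n-1)}\rangle$; in Compute it decides, deterministically or with randomness, to stay idle or move to a neighboring node; in Move it moves. If its view is symmetric ($\gamma^{+i}=\gamma^{ -i}$) and it decides to move, an adversary chooses which incident edge it traverses. At each instant $t=0,1,2,\dots$ a nonempty set of robots is activated, each executing a full cycle atomically between $t$ and $t+1$. The configuration at instant $t$ is $\langle d_0(t)\dots d_{n-1}(t)\rangle$. A tower is a node holding at least two robots; towerless means no tower. A configuration is terminal if from it the probability that some robot moves is 0. A computation is an infinite sequence of configurations starting from a possible (towerless) initial configuration, each obtained from the previous after a nonempty set of robots executes a cycle; it terminates if it contains a terminal configuration. The scheduler is distributed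 and fair (any nonempty subset may be activated; every robot is activated infinitely often). A sequential computation is one in which exactly one robot is activated per instant and every robot infinitely often. A node is visited if some robot is on it at some instant. An exploration protocol is a protocol such that every computation starting from a towerless configuration terminates in finite time (deterministic case) or finite expected time (probabilistic case) and every node is visited by at least one robot during it. $\mathcal{MRP}(s)$, the minimal relevant prefix of a sequence $s$ of configurations, is the maximal subsequence of $s$ in which no two consecutive configurations are identical. -}

module Defs where

open import Data.Nat using (ℕ; zero; suc; _+_; _∸_; _≤_; _<_)
open import Data.Nat.DivMod using (_mod_)
open import Data.Fin using (Fin; toℕ; _≟_)
open import Data.Vec using (Vec; tabulate; lookup)
open import Data.List using (length; filter; allFin)
open import Data.Bool using (Bool; true; false)
open import Data.Product using (Σ; ∃; _×_; _,_)
open import Data.Sum using (_⊎_)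
open import Data.Unit using (⊤)
open import Relation.Nullary using (¬_)
open import Relation.Binary.PropositionalEquality using (_≡_; _≢_)

_⊕_ : ∀ {n} → Fin n → ℕ → Fin n
_⊕_ {suc m} i j = (toℕ i + j) mod suc m

_⊖_ : ∀ {n} → Fin n → ℕ → Fin n
_⊖_ {suc m} i j = (toℕ i + (suc m ∸ toℕ (j mod suc m))) mod suc m

-- Configurations: ⟨d_0 … d_{n-1}⟩, d_j = number of robots on u_j.

Config : ℕ → Set
Config n = Vec ℕ n

-- Positions of the k (physically distinct, anonymous) robots.
Positions : ℕ → ℕ → Set
Positions n k = Fin k → Fin n

conf : ∀ {n k} → Positions n k → Config n
conf {n} {k} p = tabulate λ j → length (filter (λ r → p r ≟ j) (allFin k))

HasTower : ∀ {n} → Config n → Set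
HasTower d = ∃ λ j → 2 ≤ lookup d j

Towerless : ∀ {n} → Config n → Set
Towerless d = ∀ j → lookup d j ≤ 1

view+ : ∀ {n} → Config n → Fin n → Vec ℕ n
view+ d i = tabulate λ j → lookup d (i ⊕ toℕ j)

view- : ∀ {n} → Config n → Fin n → Vec ℕ n
view- d i = tabulate λ j → lookup d (i ⊖ toℕ j)

-- Protocols.  A robot's decision: stay idle, or move towards the side
-- whose view is the first (fwd) / second (bwd) component of the pair.

data Dir : Set where
  fwd bwd : Dir

data Action : Set where
  idle : Action
  move : Dir → Action

flipA : Action → Action
flipA idle = idle
flipA (move fwd) = move bwd
flipA (move bwd) = move fwd

-- A (deterministic or probabilistic) protocol, described by the
-- decisions it takes with positive probability on each view.  The view
-- is an unordered pair: the decisions on (b , a) are those on (a , b)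
-- with directions swapped.  A deterministic protocol has exactly one
-- possible decision per view.
record Protocol (n : ℕ) : Set₁ where
  field
    Possible  : Vec ℕ n → Vec ℕ n → Action → Set
    total     : ∀ a b → ∃ λ act → Possible a b act
    unordered : ∀ a b act → Possible a b act → Possible b a (flipA act)
open Protocol public

stepTo : ∀ {n} → Fin n → Dir → Fin n
stepTo i fwd = i ⊕ 1
stepTo i bwd = i ⊖ 1

-- A robot on node i of configuration d executing a cycle may end on i'.
-- (If the view is symmetric, both move decisions are possible at once,
-- which models the adversary choosing the edge.)
RobotStep : ∀ {n} → Protocol n → Config n → Fin n → Fin n → Set
RobotStep P d i i' =
  (Possible P (view+ d i) (view- d i) idle × i' ≡ i)
  ⊎ (∃ λ dir → Possible P (view+ d i) (view- d i) (move dir) × i' ≡ stepTo i dir)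

Terminal : ∀ {n} → Protocol n → Config n → Set
Terminal P d = ∀ i → 1 ≤ lookup d i → ∀ dir →
  ¬ Possible P (view+ d i) (view- d i) (move dir)

record Execution (n k : ℕ) : Set where
  field
    pos    : ℕ → Positions n k
    active : ℕ → Fin k → Bool
open Execution public

record ValidExecution {n k} (P : Protocol n) (e : Execution n k) : Set where
  field
    initial  : Towerless (conf (pos e 0))
    nonempty : ∀ t → ∃ λ r → active e t r ≡ true
    idleRob  : ∀ t r → active e t r ≡ false → pos e (suc t) r ≡ pos e t r
    moveRob  : ∀ t r → active e t r ≡ true →
               RobotStep P (conf (pos e t)) (pos e t r) (pos e (suc t) r)
    fair     : ∀ r t → ∃ λ t' → t ≤ t' × active e t' r ≡ true

IsComputation : ∀ {n} (k : ℕ) → Protocol n → (ℕ → Config n) → Set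
IsComputation {n} k P c =
  Σ (Execution n k) λ e → ValidExecution P e × (∀ t → conf (pos e t) ≡ c t)

IsSequentialComputation : ∀ {n} (k : ℕ) → Protocol n → (ℕ → Config n) → Set
IsSequentialComputation {n} k P c =
  Σ (Execution n k) λ e → ValidExecution P e × (∀ t → conf (pos e t) ≡ c t)
    × (∀ t → ∃ λ r → active e t r ≡ true × (∀ r' → active e t r' ≡ true → r' ≡ r))

Terminates : ∀ {n} → Protocol n → (ℕ → Config n) → Set
Terminates P c = ∃ λ t → Terminal P (c t)

Visited : ∀ {n} → (ℕ → Config n) → Fin n → Set
Visited c j = ∃ λ t → 1 ≤ lookup (c t) j

-- Termination part: every finite prefix
-- of a computation extends to a computation that terminates (a
-- consequence of termination in finite (expected) time).
IsExplorationProtocol : ∀ {n} (k : ℕ) → Protocol n → Set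
IsExplorationProtocol k P =
  (∀ c → IsComputation k P c → ∀ j → Visited c j)
  × (∀ c → IsComputation k P c → ∀ t → ∃ λ c' →
       IsComputation k P c' × (∀ s → s ≤ t → c' s ≡ c s) × Terminates P c')

-- Minimal relevant prefix: index t of c contributes c t to MRP(c) iff
-- t = 0 or c t differs from c (t-1).

InMRP : ∀ {n} → (ℕ → Config n) → ℕ → Set
InMRP c zero = ⊤
InMRP c (suc s) = c (suc s) ≢ c s

AtLeastTowersInMRP : ∀ {n} → ℕ → (ℕ → Config n) → Set
AtLeastTowersInMRP m c =
  Σ (Fin m → ℕ) λ f → (∀ i j → toℕ i < toℕ j → f i < f j)
    × (∀ i → InMRP c (f i) × HasTower (c (f i)))

-- The terminal configuration c T has a tower: restarted at a towerless
-- terminal configuration, the computation would never move again and would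
-- leave n − k > 0 nodes unvisited.  So there is a last towerless
-- configuration c t₀, and every later configuration has a tower.  Restarted
-- at t₀ the computation must still visit all n nodes, of which the k occupied
-- at t₀ count as visited.  One robot moves per step, so the number of visited
-- nodes grows by at most one per step, and not at all in step t₀ + 1, whose
-- robot creates a tower by landing on an occupied node.  Hence at least n − k
-- later steps reach a new node; each of them changes the configuration, as
-- does step t₀ + 1, giving n − k + 1 entries of the minimal relevant prefix,
-- all containing a tower.
module Submission where

open import Defs
open import Data.Nat using (ℕ; zero; suc; _+_; _∸_; _≤_; _<_; _≤?_; _<?_; _⊔_; z≤n; s≤s)
open import Data.Nat.Properties
  using ( ≤-refl; ≤-trans; ≤-reflexive; ≤-antisym; <⇒≤; <⇒≱; ≮⇒≥; ≰⇒>; ≤-pred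
        ; m≤m+n; m≤n+m; m≤m⊔n; m≤n⊔m; m<n⇒m<1+n; m≤n⇒m<n∨m≡n
        ; +-suc; +-comm; +-monoˡ-≤; +-monoʳ-≤; +-monoˡ-<; +-mono-≤
        ; m+1+n≰m; m+n≤o⇒m≤o∸n; m+n≤o⇒n≤o; m∸n+n≡m; m+[n∸m]≡n
        ; module ≤-Reasoning )
open import Data.Fin using (Fin; toℕ; _≟_) renaming (zero to fzero; suc to fsuc)
import Data.Fin.Properties as Fin
open import Data.Fin.Subset
  using (Subset; _∈_; _⊆_; _∪_; ⁅_⁆; ∣_∣; inside; outside) renaming (⊥ to ∅; ⊤ to full)
open import Data.Fin.Subset.Properties
  using (∉⊥; ∣⊥∣≡0; x∈p∪q⁺; x∈p∪q⁻; p⊆p∪q; x∈⁅x⁆; x∈⁅y⁆⇒x≡y; ∣⁅x⁆∣≡1; ∣p∣≤∣x∷p∣; p⊆q⇒∣p∣≤∣q∣; ∣⊤∣≡n)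
open import Data.Vec using ([]; _∷_; lookup)
open import Data.Vec.Properties using (lookup∘tabulate; tabulate-cong)
open import Data.List using (List; []; _∷_; length; filter; allFin)
open import Data.List.Properties using (filter-≐)
open import Data.List.Relation.Unary.Any using (here; there)
open import Data.List.Relation.Unary.All using ([]; _∷_)
open import Data.List.Relation.Unary.AllPairs using ([]; _∷_)
open import Data.List.Relation.Unary.Unique.Propositional using (Unique)
import Data.List.Relation.Unary.Unique.Propositional.Properties as Unique
open import Data.List.Membership.Propositional using () renaming (_∈_ to _∈ₗ_)
open import Data.List.Membership.Propositional.Properties using (∈-filter⁺; ∈-filter⁻; ∈-allFin)
open import Data.Bool using (true; false)
open import Data.Product using (∃; ∃₂; _×_; _,_; proj₁; proj₂)
open import Data.Sum using (inj₁; inj₂)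
open import Function using (_∘_; id)
open import Relation.Nullary using (¬_; Dec; yes; no; contradiction)
open import Relation.Binary.PropositionalEquality
  using (_≡_; _≢_; refl; sym; trans; cong; subst; module ≡-Reasoning)

record Chain (q : ℕ) (Q : ℕ → Set) : Set where
  constructor chain
  field
    instant    : Fin q → ℕ
    increasing : ∀ i j → toℕ i < toℕ j → instant i < instant j
    satisfies  : ∀ i → Q (instant i)

chain-map : ∀ {q} {Q R : ℕ → Set} (g : ℕ → ℕ) → (∀ {s t} → s < t → g s < g t) →
            (∀ {t} → Q t → R (g t)) → Chain q Q → Chain q R
chain-map g g-mono Q⇒R (chain f f-mono Qf) =
  chain (g ∘ f) (λ i j i<j → g-mono (f-mono i j i<j)) (λ i → Q⇒R (Qf i))

chain-weaken : ∀ {q} {Q R : ℕ → Set} → (∀ {t} → Q t → R t) → Chain q Q → Chain q R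
chain-weaken = chain-map id id

chain-cons : ∀ {q a} {Q : ℕ → Set} → Q a → Chain q (λ t → a < t × Q t) →
             Chain (suc q) (λ t → a ≤ t × Q t)
chain-cons {q} {a} {Q} Qa (chain f f-mono Qf) = chain g g-mono Qg
  where
    g : Fin (suc q) → ℕ
    g fzero    = a
    g (fsuc i) = f i

    g-mono : ∀ i j → toℕ i < toℕ j → g i < g j
    g-mono fzero    (fsuc j) _         = proj₁ (Qf j)
    g-mono (fsuc i) (fsuc j) (s≤s i<j) = f-mono i j i<j

    Qg : ∀ i → a ≤ g i × Q (g i)
    Qg fzero    = ≤-refl , Qa
    Qg (fsuc i) = <⇒≤ (proj₁ (Qf i)) , proj₂ (Qf i)

chain⇒atLeastTowersInMRP : ∀ {n m} {c : ℕ → Config n} →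
                           Chain m (λ t → InMRP c t × HasTower (c t)) → AtLeastTowersInMRP m c
chain⇒atLeastTowersInMRP (chain f increasing towers) = f , increasing , towers

strict-rises : (V : ℕ → ℕ) → (∀ m → V (suc m) ≤ suc (V m)) →
               ∀ d a q → V a + q ≤ V (d + a) → Chain q (λ m → a ≤ m × V m < V (suc m))
strict-rises V step d       a zero    _  = chain (λ ()) (λ ()) (λ ())
strict-rises V step zero    a (suc q) le = contradiction le (m+1+n≰m (V a))
strict-rises V step (suc d) a (suc q) le = rises-at-a-or-later (V a <? V (suc a))
  where
    le′ : V a + suc q ≤ V (d + suc a)
    le′ = subst (λ x → V a + suc q ≤ V x) (sym (+-suc d a)) le

    rises-at-a-or-later : Dec (V a < V (suc a)) → Chain (suc q) (λ m → a ≤ m × V m < V (suc m))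
    rises-at-a-or-later (yes rise) = chain-cons rise (strict-rises V step d (suc a) q
      (≤-trans (+-monoˡ-≤ q (step a)) (≤-trans (≤-reflexive (sym (+-suc (V a) q))) le′)))
    rises-at-a-or-later (no ¬rise) = chain-weaken (λ (a<m , rise) → <⇒≤ a<m , rise)
      (strict-rises V step d (suc a) (suc q) (≤-trans (+-monoˡ-≤ (suc q) (≮⇒≥ ¬rise)) le′))

uniform-instant : ∀ {n} (Q : Fin n → ℕ → Set) → (∀ j {s s′} → s ≤ s′ → Q j s → Q j s′) →
                  (∀ j → ∃ (Q j)) → ∃ λ M → ∀ j → Q j M
uniform-instant {zero}  Q up ex = 0 , λ ()
uniform-instant {suc n} Q up ex with ex fzero | uniform-instant (Q ∘ fsuc) (up ∘ fsuc) (ex ∘ fsuc)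
... | s , Q₀s | M , QM = s ⊔ M , λ { fzero    → up fzero (m≤m⊔n s M) Q₀s
                                   ; (fsuc j) → up (fsuc j) (m≤n⊔m s M) (QM j) }

last-before : {Q : ℕ → Set} → (∀ t → Dec (Q t)) → Q 0 → ∀ T → ¬ Q T →
              ∃ λ t → t < T × Q t × (∀ s → t < s → s ≤ T → ¬ Q s)
last-before Q? Q0 zero    ¬QT = contradiction Q0 ¬QT
last-before {Q} Q? Q0 (suc T) ¬Q1+T with Q? T
... | yes QT = T , ≤-refl , QT , λ s T<s s≤1+T → subst (¬_ ∘ Q) (≤-antisym T<s s≤1+T) ¬Q1+T
... | no ¬QT with last-before Q? Q0 T ¬QT
...   | t , t<T , Qt , after = t , m<n⇒m<1+n t<T , Qt , after′
  where
    after′ : ∀ s → t < s → s ≤ suc T → ¬ Q s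
    after′ s t<s s≤1+T with m≤n⇒m<n∨m≡n s≤1+T
    ... | inj₁ s<1+T = after s t<s (≤-pred s<1+T)
    ... | inj₂ refl  = ¬Q1+T

∣p∪q∣≤∣p∣+∣q∣ : ∀ {n} (p q : Subset n) → ∣ p ∪ q ∣ ≤ ∣ p ∣ + ∣ q ∣
∣p∪q∣≤∣p∣+∣q∣ []            []            = z≤n
∣p∪q∣≤∣p∣+∣q∣ (outside ∷ p) (outside ∷ q) = ∣p∪q∣≤∣p∣+∣q∣ p q
∣p∪q∣≤∣p∣+∣q∣ (outside ∷ p) (inside  ∷ q) =
  ≤-trans (s≤s (∣p∪q∣≤∣p∣+∣q∣ p q)) (≤-reflexive (sym (+-suc ∣ p ∣ ∣ q ∣)))
∣p∪q∣≤∣p∣+∣q∣ (inside  ∷ p) (s ∷ q)       =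
  s≤s (≤-trans (∣p∪q∣≤∣p∣+∣q∣ p q) (+-monoʳ-≤ ∣ p ∣ (∣p∣≤∣x∷p∣ s q)))

∪-least : ∀ {n} {p q r : Subset n} → p ⊆ r → q ⊆ r → p ∪ q ⊆ r
∪-least {p = p} {q} p⊆r q⊆r x∈p∪q with x∈p∪q⁻ p q x∈p∪q
... | inj₁ x∈p = p⊆r x∈p
... | inj₂ x∈q = q⊆r x∈q

∣p∪q∣≤∣p∣ : ∀ {n} (p q : Subset n) → q ⊆ p → ∣ p ∪ q ∣ ≤ ∣ p ∣
∣p∪q∣≤∣p∣ p q q⊆p = p⊆q⇒∣p∣≤∣q∣ (∪-least id q⊆p)

∣p∪q∣≤1+∣p∣ : ∀ {n} (p q : Subset n) x → q ⊆ p ∪ ⁅ x ⁆ → ∣ p ∪ q ∣ ≤ suc ∣ p ∣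
∣p∪q∣≤1+∣p∣ p q x q⊆p∪x = begin
  ∣ p ∪ q ∣         ≤⟨ p⊆q⇒∣p∣≤∣q∣ (∪-least (p⊆p∪q ⁅ x ⁆) q⊆p∪x) ⟩
  ∣ p ∪ ⁅ x ⁆ ∣     ≤⟨ ∣p∪q∣≤∣p∣+∣q∣ p ⁅ x ⁆ ⟩
  ∣ p ∣ + ∣ ⁅ x ⁆ ∣ ≡⟨ cong (∣ p ∣ +_) (∣⁅x⁆∣≡1 x) ⟩
  ∣ p ∣ + 1         ≡⟨ +-comm ∣ p ∣ 1 ⟩
  suc ∣ p ∣         ∎
  where open ≤-Reasoning

image : ∀ {n k} → (Fin k → Fin n) → Subset n
image {k = zero}  p = ∅
image {k = suc k} p = ⁅ p fzero ⁆ ∪ image (p ∘ fsuc)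

∈-image⁺ : ∀ {n k} (p : Fin k → Fin n) r → p r ∈ image p
∈-image⁺ p fzero    = x∈p∪q⁺ (inj₁ (x∈⁅x⁆ (p fzero)))
∈-image⁺ p (fsuc r) = x∈p∪q⁺ (inj₂ (∈-image⁺ (p ∘ fsuc) r))

∈-image⁻ : ∀ {n k} (p : Fin k → Fin n) {j} → j ∈ image p → ∃ λ r → p r ≡ j
∈-image⁻ {k = zero}  p j∈ = contradiction j∈ ∉⊥
∈-image⁻ {k = suc k} p j∈ with x∈p∪q⁻ ⁅ p fzero ⁆ (image (p ∘ fsuc)) j∈
... | inj₁ j∈⁅p0⁆ = fzero , sym (x∈⁅y⁆⇒x≡y (p fzero) j∈⁅p0⁆)
... | inj₂ j∈rest with ∈-image⁻ (p ∘ fsuc) j∈rest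
...   | r , pr≡j = fsuc r , pr≡j

image-⊆ : ∀ {n k} (p : Fin k → Fin n) {s : Subset n} → (∀ r → p r ∈ s) → image p ⊆ s
image-⊆ p p⊆s j∈ with ∈-image⁻ p j∈
... | r , refl = p⊆s r

∣image∣≤ : ∀ {n k} (p : Fin k → Fin n) → ∣ image p ∣ ≤ k
∣image∣≤ {n} {zero}  p = ≤-reflexive (∣⊥∣≡0 n)
∣image∣≤ {n} {suc k} p = begin
  ∣ ⁅ p fzero ⁆ ∪ image (p ∘ fsuc) ∣       ≤⟨ ∣p∪q∣≤∣p∣+∣q∣ ⁅ p fzero ⁆ (image (p ∘ fsuc)) ⟩
  ∣ ⁅ p fzero ⁆ ∣ + ∣ image (p ∘ fsuc) ∣   ≤⟨ +-mono-≤ (≤-reflexive (∣⁅x⁆∣≡1 (p fzero))) (∣image∣≤ (p ∘ fsuc)) ⟩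
  suc k                                   ∎
  where open ≤-Reasoning

no-surjection : ∀ {k n} → k < n → (p : Fin k → Fin n) → ¬ (∀ j → ∃ λ r → p r ≡ j)
no-surjection k<n p onto with Fin.pigeonhole k<n (proj₁ ∘ onto)
... | i , j , i<j , same =
  Fin.<-irrefl (trans (sym (proj₂ (onto i))) (trans (cong p same) (proj₂ (onto j)))) i<j

∈⇒1≤length : ∀ {A : Set} {x : A} {xs} → x ∈ₗ xs → 1 ≤ length xs
∈⇒1≤length (here _)  = s≤s z≤n
∈⇒1≤length (there _) = s≤s z≤n

1≤length⇒∈ : ∀ {A : Set} {xs : List A} → 1 ≤ length xs → ∃ λ x → x ∈ₗ xs
1≤length⇒∈ {xs = x ∷ _} _ = x , here refl

distinct⇒2≤length : ∀ {A : Set} {x y : A} {xs} → x ≢ y → x ∈ₗ xs → y ∈ₗ xs → 2 ≤ length xs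
distinct⇒2≤length {xs = _ ∷ []}    x≢y (here refl) (here refl) = contradiction refl x≢y
distinct⇒2≤length {xs = _ ∷ []}    _   (there ())  _
distinct⇒2≤length {xs = _ ∷ []}    _   _           (there ())
distinct⇒2≤length {xs = _ ∷ _ ∷ _} _   _           _           = s≤s (s≤s z≤n)

2≤length⇒distinct : ∀ {A : Set} {xs : List A} → Unique xs → 2 ≤ length xs →
                    ∃₂ λ x y → x ≢ y × x ∈ₗ xs × y ∈ₗ xs
2≤length⇒distinct {xs = _ ∷ []}    _               (s≤s ())
2≤length⇒distinct {xs = x ∷ y ∷ _} ((x≢y ∷ _) ∷ _) _ = x , y , x≢y , here refl , there (here refl)

robotsAt : ∀ {n k} → Positions n k → Fin n → List (Fin k)
robotsAt {k = k} p j = filter (λ r → p r ≟ j) (allFin k)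

module _ {n k} (p : Positions n k) {j : Fin n} where

  private
    lookup-conf : lookup (conf p) j ≡ length (robotsAt p j)
    lookup-conf = lookup∘tabulate _ j

    ∈-robotsAt⁺ : ∀ {r} → p r ≡ j → r ∈ₗ robotsAt p j
    ∈-robotsAt⁺ {r} = ∈-filter⁺ (λ r → p r ≟ j) {xs = allFin k} (∈-allFin r)

    ∈-robotsAt⁻ : ∀ {r} → r ∈ₗ robotsAt p j → p r ≡ j
    ∈-robotsAt⁻ r∈ = proj₂ (∈-filter⁻ (λ r → p r ≟ j) {xs = allFin k} r∈)

  robot⇒occupied : ∀ {r} → p r ≡ j → 1 ≤ lookup (conf p) j
  robot⇒occupied pr≡j = subst (1 ≤_) (sym lookup-conf) (∈⇒1≤length (∈-robotsAt⁺ pr≡j))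

  occupied⇒robot : 1 ≤ lookup (conf p) j → ∃ λ r → p r ≡ j
  occupied⇒robot occ with 1≤length⇒∈ (subst (1 ≤_) lookup-conf occ)
  ... | r , r∈ = r , ∈-robotsAt⁻ r∈

  robots⇒tower : ∀ {r r′} → r ≢ r′ → p r ≡ j → p r′ ≡ j → 2 ≤ lookup (conf p) j
  robots⇒tower r≢r′ pr≡j pr′≡j =
    subst (2 ≤_) (sym lookup-conf) (distinct⇒2≤length r≢r′ (∈-robotsAt⁺ pr≡j) (∈-robotsAt⁺ pr′≡j))

  tower⇒robots : 2 ≤ lookup (conf p) j → ∃₂ λ r r′ → r ≢ r′ × p r ≡ j × p r′ ≡ j
  tower⇒robots tower
    with 2≤length⇒distinct (Unique.filter⁺ (λ r → p r ≟ j) (Unique.allFin⁺ k)) (subst (2 ≤_) lookup-conf tower)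
  ... | r , r′ , r≢r′ , r∈ , r′∈ = r , r′ , r≢r′ , ∈-robotsAt⁻ r∈ , ∈-robotsAt⁻ r′∈

conf-cong : ∀ {n k} {p q : Positions n k} → (∀ r → p r ≡ q r) → conf p ≡ conf q
conf-cong {k = k} {p} {q} p≗q = tabulate-cong λ j →
  cong length (filter-≐ (λ r → p r ≟ j) (λ r → q r ≟ j)
                        ((λ {r} → trans (sym (p≗q r))) , (λ {r} → trans (p≗q r))) (allFin k))

Collision : ∀ {n k} → Positions n k → Set
Collision p = ∃₂ λ r r′ → r ≢ r′ × p r ≡ p r′

hasTower⇒collision : ∀ {n k} (p : Positions n k) → HasTower (conf p) → Collision p
hasTower⇒collision p (j , tower) with tower⇒robots p tower
... | r , r′ , r≢r′ , pr≡j , pr′≡j = r , r′ , r≢r′ , trans pr≡j (sym pr′≡j)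

towerless⇒¬collision : ∀ {n k} (p : Positions n k) → Towerless (conf p) → ¬ Collision p
towerless⇒¬collision p towerless (r , r′ , r≢r′ , same) =
  <⇒≱ (robots⇒tower p r≢r′ same refl) (towerless (p r′))

towerless? : ∀ {n} (d : Config n) → Dec (Towerless d)
towerless? d = Fin.all? (λ j → lookup d j ≤? 1)

¬towerless⇒hasTower : ∀ {n} (d : Config n) → ¬ Towerless d → HasTower d
¬towerless⇒hasTower {n} d ¬towerless with Fin.¬∀⟶∃¬ n _ (λ j → lookup d j ≤? 1) ¬towerless
... | j , ≰1 = j , ≰⇒> ≰1

hasTower⇒¬towerless : ∀ {n} (d : Config n) → HasTower d → ¬ Towerless d
hasTower⇒¬towerless d (j , tower) towerless = <⇒≱ tower (towerless j)

moved-onto-robot : ∀ {n k} {p q : Positions n k} (mv : Fin k) → (∀ r → r ≢ mv → q r ≡ p r) →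
                   ¬ Collision p → Collision q → ∀ r → q r ∈ image p
moved-onto-robot {p = p} {q} mv stay ¬collision (r₁ , r₂ , r₁≢r₂ , same) r with r ≟ mv
... | no r≢mv = subst (_∈ image p) (sym (stay r r≢mv)) (∈-image⁺ p r)
... | yes refl with r₁ ≟ r | r₂ ≟ r
...   | yes refl | _        = subst (_∈ image p) (sym (trans same (stay r₂ (r₁≢r₂ ∘ sym)))) (∈-image⁺ p r₂)
...   | no r₁≢r  | yes refl = subst (_∈ image p) (sym (trans (sym same) (stay r₁ r₁≢r))) (∈-image⁺ p r₁)
...   | no r₁≢r  | no r₂≢r  = contradiction
          (r₁ , r₂ , r₁≢r₂ , trans (sym (stay r₁ r₁≢r)) (trans same (stay r₂ r₂≢r))) ¬collision

visitedUpTo : ∀ {n k} → (ℕ → Positions n k) → ℕ → Subset n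
visitedUpTo ps zero    = image (ps 0)
visitedUpTo ps (suc m) = visitedUpTo ps m ∪ image (ps (suc m))

image⊆visitedUpTo : ∀ {n k} (ps : ℕ → Positions n k) m → image (ps m) ⊆ visitedUpTo ps m
image⊆visitedUpTo ps zero    = id
image⊆visitedUpTo ps (suc m) = x∈p∪q⁺ ∘ inj₂

visitedUpTo-mono : ∀ {n k} (ps : ℕ → Positions n k) {m m′} → m ≤ m′ →
                   visitedUpTo ps m ⊆ visitedUpTo ps m′
visitedUpTo-mono ps {m′ = zero}   z≤n = id
visitedUpTo-mono ps {m′ = suc m′} m≤1+m′ with m≤n⇒m<n∨m≡n m≤1+m′
... | inj₁ m<1+m′ = x∈p∪q⁺ ∘ inj₁ ∘ visitedUpTo-mono ps (≤-pred m<1+m′)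
... | inj₂ refl   = id

module _ {n k} {P : Protocol n} {e : Execution n k} {c : ℕ → Config n}
         (valid : ValidExecution P e) (corr : ∀ t → conf (pos e t) ≡ c t) where

  open ValidExecution valid

  suffix-isComputation : ∀ t → Towerless (c t) → IsComputation k P (λ s → c (s + t))
  suffix-isComputation t towerless = suffix , suffix-valid , λ s → corr (s + t)
    where
      suffix : Execution n k
      suffix = record { pos = λ s → pos e (s + t) ; active = λ s → active e (s + t) }

      activated-later : ∀ r s → (∃ λ t′ → s + t ≤ t′ × active e t′ r ≡ true) →
                        ∃ λ t′ → s ≤ t′ × active e (t′ + t) r ≡ true
      activated-later r s (t′ , s+t≤t′ , act) =
        t′ ∸ t , m+n≤o⇒m≤o∸n s s+t≤t′ ,
        subst (λ u → active e u r ≡ true) (sym (m∸n+n≡m (m+n≤o⇒n≤o s s+t≤t′))) act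

      suffix-valid : ValidExecution P suffix
      suffix-valid = record
        { initial  = subst Towerless (sym (corr t)) towerless
        ; nonempty = λ s → nonempty (s + t)
        ; idleRob  = λ s → idleRob (s + t)
        ; moveRob  = λ s → moveRob (s + t)
        ; fair     = λ r s → activated-later r s (fair r (s + t))
        }

  robot⇒occupied-at : ∀ t r → 1 ≤ lookup (c t) (pos e t r)
  robot⇒occupied-at t r = subst (λ d → 1 ≤ lookup d (pos e t r)) (corr t) (robot⇒occupied (pos e t) refl)

  occupied⇒robot-at : ∀ t {j} → 1 ≤ lookup (c t) j → ∃ λ r → pos e t r ≡ j
  occupied⇒robot-at t {j} occ = occupied⇒robot (pos e t) (subst (λ d → 1 ≤ lookup d j) (sym (corr t)) occ)

  terminal⇒fixed : ∀ t → Terminal P (c t) → ∀ r → pos e (suc t) r ≡ pos e t r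
  terminal⇒fixed t term r with active e t r in act
  ... | false = idleRob t r act
  ... | true with moveRob t r act
  ...   | inj₁ (_ , stays)          = stays
  ...   | inj₂ (dir , can-move , _) = contradiction can-move
            (subst (Terminal P) (sym (corr t)) term (pos e t r) (robot⇒occupied (pos e t) refl) dir)

  terminal⇒constant : ∀ T → Terminal P (c T) → ∀ s → c (s + T) ≡ c T
  terminal⇒constant T term zero    = refl
  terminal⇒constant T term (suc s) = begin
    c (suc s + T)              ≡⟨ sym (corr (suc s + T)) ⟩
    conf (pos e (suc (s + T))) ≡⟨ conf-cong (terminal⇒fixed (s + T) (subst (Terminal P) (sym ih) term)) ⟩
    conf (pos e (s + T))       ≡⟨ corr (s + T) ⟩
    c (s + T)                  ≡⟨ ih ⟩
    c T                        ∎
    where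
      open ≡-Reasoning
      ih = terminal⇒constant T term s

  terminal⇒¬towerless : k < n → IsExplorationProtocol k P → ∀ T → Terminal P (c T) → ¬ Towerless (c T)
  terminal⇒¬towerless k<n (visits , _) T term towerless = no-surjection k<n (pos e T) λ j →
    let s , occ = visits _ (suffix-isComputation T towerless) j
    in occupied⇒robot-at T (subst (λ d → 1 ≤ lookup d j) (terminal⇒constant T term s) occ)

  towers-after-last-towerless : k < n → IsExplorationProtocol k P → ∀ T → Terminal P (c T) →
                                ∃ λ t₀ → Towerless (c t₀) × (∀ s → t₀ < s → HasTower (c s))
  towers-after-last-towerless k<n explore T term
    with last-before (towerless? ∘ c) (subst Towerless (corr 0) initial) T
                     (terminal⇒¬towerless k<n explore T term)
  ... | t₀ , t₀<T , towerless , towered = t₀ , towerless , λ s t₀<s → ¬towerless⇒hasTower (c s) (¬towerless s t₀<s)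
    where
      ¬towerless : ∀ s → t₀ < s → ¬ Towerless (c s)
      ¬towerless s t₀<s with s ≤? T
      ... | yes s≤T = towered s t₀<s s≤T
      ... | no  s≰T = subst (¬_ ∘ Towerless)
                        (trans (sym (terminal⇒constant T term (s ∸ T))) (cong c (m∸n+n≡m (<⇒≤ (≰⇒> s≰T)))))
                        (terminal⇒¬towerless k<n explore T term)

  module Sequential (sequential : ∀ t → ∃ λ r → active e t r ≡ true × (∀ r′ → active e t r′ ≡ true → r′ ≡ r))
    where

    one-robot-moves : ∀ t → ∃ λ mv → ∀ r → r ≢ mv → pos e (suc t) r ≡ pos e t r
    one-robot-moves t = proj₁ (sequential t) , stay
      where
        stay : ∀ r → r ≢ proj₁ (sequential t) → pos e (suc t) r ≡ pos e t r
        stay r r≢mv with active e t r in act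
        ... | true  = contradiction (proj₂ (proj₂ (sequential t)) r act) r≢mv
        ... | false = idleRob t r act

  module SequentialFrom (sequential : ∀ t → ∃ λ r → active e t r ≡ true × (∀ r′ → active e t r′ ≡ true → r′ ≡ r))
                        (t₀ : ℕ) where

    open Sequential sequential

    positions : ℕ → Positions n k
    positions m = pos e (m + t₀)

    visited : ℕ → Subset n
    visited = visitedUpTo positions

    robot⇒visited : ∀ m {r j} → positions m r ≡ j → j ∈ visited m
    robot⇒visited m {r} refl = image⊆visitedUpTo positions m (∈-image⁺ (positions m) r)

    ∣visited0∣≤k : ∣ visited 0 ∣ ≤ k
    ∣visited0∣≤k = ∣image∣≤ (pos e t₀)

    ∣visited-suc∣≤ : ∀ m → ∣ visited (suc m) ∣ ≤ suc ∣ visited m ∣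
    ∣visited-suc∣≤ m with one-robot-moves (m + t₀)
    ... | mv , stay = ∣p∪q∣≤1+∣p∣ (visited m) _ (positions (suc m) mv) (image-⊆ _ moved)
      where
        moved : ∀ r → positions (suc m) r ∈ visited m ∪ ⁅ positions (suc m) mv ⁆
        moved r with r ≟ mv
        ... | yes refl = x∈p∪q⁺ (inj₂ (x∈⁅x⁆ _))
        ... | no r≢mv  = x∈p∪q⁺ (inj₁ (robot⇒visited m (sym (stay r r≢mv))))

    ∣visited1∣≤∣visited0∣ : Towerless (c t₀) → HasTower (c (suc t₀)) → ∣ visited 1 ∣ ≤ ∣ visited 0 ∣
    ∣visited1∣≤∣visited0∣ towerless tower with one-robot-moves t₀
    ... | mv , stay = ∣p∪q∣≤∣p∣ (visited 0) _ (image-⊆ _ (moved-onto-robot mv stay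
            (towerless⇒¬collision (pos e t₀) (subst Towerless (sym (corr t₀)) towerless))
            (hasTower⇒collision (pos e (suc t₀)) (subst HasTower (sym (corr (suc t₀))) tower))))

    visited-grows⇒moved : ∀ m → ∣ visited m ∣ < ∣ visited (suc m) ∣ → InMRP c (suc (m + t₀))
    visited-grows⇒moved m grows same = <⇒≱ grows (∣p∪q∣≤∣p∣ (visited m) _ (image-⊆ _ unmoved))
      where
        unmoved : ∀ r → positions (suc m) r ∈ visited m
        unmoved r with occupied⇒robot-at (m + t₀)
                         (subst (λ d → 1 ≤ lookup d _) same (robot⇒occupied-at (suc m + t₀) r))
        ... | _ , at = robot⇒visited m at

    eventually-visited : IsExplorationProtocol k P → Towerless (c t₀) → ∃ λ M → ∀ j → j ∈ visited M
    eventually-visited (visits , _) towerless =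
      uniform-instant (λ j M → j ∈ visited M) (λ j s≤s′ → visitedUpTo-mono positions s≤s′) visited-once
      where
        visited-once : ∀ j → ∃ λ M → j ∈ visited M
        visited-once j with visits _ (suffix-isComputation t₀ towerless) j
        ... | M , occ with occupied⇒robot-at (M + t₀) occ
        ...   | _ , at = M , robot⇒visited M at

    new-node-instants : IsExplorationProtocol k P → k < n → Towerless (c t₀) → (∀ s → t₀ < s → HasTower (c s)) →
                        Chain (n ∸ k) (λ t → suc t₀ < t × InMRP c t × HasTower (c t))
    new-node-instants explore k<n towerless towered =
      chain-map (λ m → suc (m + t₀)) (λ s<t → s≤s (+-monoˡ-< t₀ s<t)) new-node-instant
        (strict-rises V ∣visited-suc∣≤ M 1 (n ∸ k) gain)
      where
        V : ℕ → ℕ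
        V m = ∣ visited m ∣

        new-node-instant : ∀ {m} → 1 ≤ m × V m < V (suc m) →
                           suc t₀ < suc (m + t₀) × InMRP c (suc (m + t₀)) × HasTower (c (suc (m + t₀)))
        new-node-instant {m} (1≤m , grows) =
          s≤s (+-monoˡ-≤ t₀ 1≤m) , visited-grows⇒moved m grows , towered _ (s≤s (m≤n+m t₀ m))

        M : ℕ
        M = proj₁ (eventually-visited explore towerless)

        all-visited : full ⊆ visited (M + 1)
        all-visited {j} _ = visitedUpTo-mono positions (m≤m+n M 1) (proj₂ (eventually-visited explore towerless) j)

        gain : V 1 + (n ∸ k) ≤ V (M + 1)
        gain = begin
          V 1 + (n ∸ k) ≤⟨ +-monoˡ-≤ (n ∸ k) (≤-trans (∣visited1∣≤∣visited0∣ towerless (towered _ ≤-refl)) ∣visited0∣≤k) ⟩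
          k + (n ∸ k)   ≡⟨ m+[n∸m]≡n (<⇒≤ k<n) ⟩
          n             ≡⟨ sym (∣⊤∣≡n n) ⟩
          ∣ full {n} ∣  ≤⟨ p⊆q⇒∣p∣≤∣q∣ all-visited ⟩
          V (M + 1)     ∎
          where open ≤-Reasoning

lemma2 : (n k : ℕ) → k < n → (P : Protocol n) → IsExplorationProtocol k P →
    (c : ℕ → Config n) → IsSequentialComputation k P c → Terminates P c →
    AtLeastTowersInMRP (n ∸ k + 1) c
lemma2 n k k<n P explore c (e , valid , corr , sequential) (T , term)
  with towers-after-last-towerless valid corr k<n explore T term
... | t₀ , towerless , towered =
  subst (λ m → AtLeastTowersInMRP m c) (+-comm 1 (n ∸ k))
    (chain⇒atLeastTowersInMRP (chain-weaken proj₂ (chain-cons (first-change , towered (suc t₀) ≤-refl)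
      (SequentialFrom.new-node-instants valid corr sequential t₀ explore k<n towerless towered))))
  where
    first-change : InMRP c (suc t₀)
    first-change same = hasTower⇒¬towerless (c (suc t₀)) (towered (suc t₀) ≤-refl)
                          (subst Towerless (sym same) towerless)
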